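{- Let $\mathbf c$ be a linear order on $c_1,\dots,c_t$ and let $v=v_1,v_2,\dots,v_{n+1}=v'$ be an ordered path in $\mathscr G(\mathbf c)$, where $v_p,v_{p+1}$ are joined by an edge of label $i_p$ ($1\le p\le n$), and let $k_p$ be the label of $v_p$ ($1\le p\le n+1$). Then (1) the $i_p$, $1\le p\le n$, are pairwise distinct; (2) the $k_p$, $1\le p\le n+1$, are pairwise distinct.
   Context: Let $T=\{1,\dots,t\}$. A linear order $\mathbf c$ on symbols $c_1,\dots,c_t$ determines a labelled graph $\mathscr G(\mathbf c)$ (vertices labelled in $\{1,\dots,t+1\}$, edges labelled in $T$), defined inductively. For $t=1$: two vertices labelled $1$ and $2$ joined by an edge labelled $1$. For $t\ge2$: let $c_s$ be the maximal element of $\mathbf c$. Let $\mathbf c'$ be the induced order on $\mathbf c\setminus\{c_s\}$, reindexed by keeping indices $<s$ and decreasing indices $>s$ by $1$; let $\mathscr G'=\mathscr G(\mathbf c')$. Let $\mathscr G^+$ be a copy of $\mathscr G'$ in which every label (on vertices and edges) $\ell\le s-1$ is kept and every label $\ell\ge s$ is replaced by $\ell+1$. Let $\mathscr G^-$ be a second copy of the same underlying graph, with $\varphi:\mathscr G^+\to\mathscr G^-$ the identification, carrying the same labels except that vertices labelled $s+1$ in $\mathscr G^+$ are labelled $s$ in $\mathscr G^-$. Then $\mathscr G(\mathbf c)$ is the disjoint union of $\mathscr G^+$ and $\mathscr G^-$ together with, for each vertex $v$ of $\mathscr G^+$ of label $s+1$, an edge labelled $s$ joining $v$ and $\varphi(v)$.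 An ordered path is a sequence of vertices $v_1,\dots,v_{n+1}$ with $v_p,v_{p+1}$ joined by an edge of label $i_p$ and $c_{i_1}<c_{i_2}<\dots<c_{i_n}$ in the order $\mathbf c$. -}

module Defs where

open import Data.Nat using (ℕ; zero; suc; _∸_; _<ᵇ_; _≡ᵇ_)
open import Data.Bool using (Bool; true; false; if_then_else_)
open import Data.List using (List; []; _∷_; _++_; [_]; map; reverse; upTo)
open import Data.List.Relation.Binary.Permutation.Propositional using (_↭_)
open import Data.Product using (_×_; _,_; ∃-syntax)
open import Data.Sum using (_⊎_)
open import Relation.Binary.PropositionalEquality using (_≡_)

-- Symbols c_1,…,c_t are identified with their indices 1,…,t (1-based, as in the paper).
-- A linear order c on them is given by the list of indices in increasing order
-- (first = minimal, last = maximal).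
IsLinearOrder : ℕ → List ℕ → Set
IsLinearOrder t cs = cs ↭ map suc (upTo t)

_<[_]_ : ℕ → List ℕ → ℕ → Set
i <[ cs ] j = ∃[ xs ] ∃[ ys ] ∃[ zs ] (cs ≡ xs ++ [ i ] ++ ys ++ [ j ] ++ zs)

-- Relabelling for G⁺ : labels ℓ ≤ s-1 kept, labels ℓ ≥ s become ℓ+1.
shift : ℕ → ℕ → ℕ
shift s ℓ = if ℓ <ᵇ s then ℓ else suc ℓ

-- Reindexing of c' : indices < s kept, indices > s decreased by 1.
red : ℕ → ℕ → ℕ
red s j = if j <ᵇ s then j else j ∸ 1

-- Label change for G⁻ : vertices labelled s+1 in G⁺ are labelled s.
minusLab : ℕ → ℕ → ℕ
minusLab s ℓ = if ℓ ≡ᵇ suc s then s else ℓ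

-- Vertices of G(c) for t = suc n (2^t of them): Bool for t = 1, and for
-- t ≥ 2 a pair (true = copy in G⁺, false = copy in G⁻) with a vertex of G(c').
Vtx : ℕ → Set
Vtx zero = Bool
Vtx (suc n) = Bool × Vtx n

-- Internally the graph is built from the order listed in DECREASING order
-- (head = maximal element c_s).
-- vlab n ds v : label of vertex v in G(c), t = suc n, ds = reverse of the order.
vlab : (n : ℕ) → List ℕ → Vtx n → ℕ
vlab zero _ false = 1
vlab zero _ true = 2
vlab (suc n) [] _ = 0   -- junk, never used for genuine orders
vlab (suc n) (s ∷ ds) (true , v) = shift s (vlab n (map (red s) ds) v)
vlab (suc n) (s ∷ ds) (false , v) = minusLab s (shift s (vlab n (map (red s) ds) v))

-- Directed incidence: Adj n ds v w i  means an edge labelled i joins v and w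
-- (listed in one orientation).
data Adj : (n : ℕ) → List ℕ → Vtx n → Vtx n → ℕ → Set where
  base  : ∀ {ds} → Adj zero ds false true 1
  plus  : ∀ {n s ds v w ℓ} → Adj n (map (red s) ds) v w ℓ →
          Adj (suc n) (s ∷ ds) (true , v) (true , w) (shift s ℓ)
  minus : ∀ {n s ds v w ℓ} → Adj n (map (red s) ds) v w ℓ →
          Adj (suc n) (s ∷ ds) (false , v) (false , w) (shift s ℓ)
  cross : ∀ {n s ds v} → vlab (suc n) (s ∷ ds) (true , v) ≡ suc s →
          Adj (suc n) (s ∷ ds) (true , v) (false , v) s

label : (n : ℕ) → List ℕ → Vtx n → ℕ
label n cs = vlab n (reverse cs)

Joined : (n : ℕ) → List ℕ → Vtx n → Vtx n → ℕ → Set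
Joined n cs v w i = Adj n (reverse cs) v w i ⊎ Adj n (reverse cs) w v i

module Submission where

-- Induction on t, following the construction of G(c)
-- from two relabelled copies G⁺, G⁻ of G(c'), where c_s is the maximal symbol:
--   * an edge labelled s is a cross edge between the copies; as c_s is maximal and
--     occurs once in the order, it can only be the LAST edge of an ordered path;
--   * a path avoiding the label s stays in one copy; the relabellings shift and
--     minusLab ∘ shift are injective and red undoes shift, so the path projects to an
--     ordered path of G(c') with the same coincidences of labels, and induction applies;
--   * if the last edge is the cross edge, the final vertex has label s (leaving G⁺) or
--     s+1 (leaving G⁻), which never occurs in the copy holding the rest of the path.

open import Defs
open import Data.Nat using (ℕ; zero; suc; _∸_; _<ᵇ_; _≡ᵇ_; _<_; _≤_; s≤s; _<?_; _≟_)
open import Data.Nat.Properties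
  using (<ᵇ-reflects-<; ≡ᵇ⇒≡; ≡⇒≡ᵇ; <⇒≱; ≮⇒≥; m≤n⇒m≤1+n; <-irrefl; 1+n≢n; 1+n≰n; <-cmp; suc-injective)
open import Data.Fin using (Fin; toℕ; inject₁; fromℕ) renaming (zero to fzero; suc to fsuc)
open import Data.Fin.Properties using (toℕ-inject₁)
open import Data.Fin.Relation.Unary.Top using (view; ‵fromℕ; ‵inject₁)
open import Data.List using (List; []; _∷_; _++_; map; reverse)
open import Data.List.Properties using (∷-injectiveˡ; ∷-injectiveʳ; map-++; reverse-++; unfold-reverse; ++-assoc)
open import Data.List.Membership.Propositional using (_∈_)
open import Data.List.Membership.Propositional.Properties using (∈-++⁺ʳ)
open import Data.List.Relation.Unary.Any using (here; there)
open import Data.List.Relation.Unary.All as All using (All; []; _∷_)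
open import Data.List.Relation.Unary.AllPairs using ([]; _∷_)
open import Data.List.Relation.Unary.Unique.Propositional using (Unique)
import Data.List.Relation.Unary.Unique.Propositional.Properties as UniqueProps
open import Data.List.Relation.Binary.Permutation.Propositional using (↭-sym; ↭-trans; ↭⇒↭ₛ)
open import Data.List.Relation.Binary.Permutation.Propositional.Properties using (↭-reverse)
open import Data.List.Relation.Binary.Permutation.Setoid.Properties using (Unique-resp-↭)
open import Data.Bool using (true; false)
open import Data.Empty using (⊥-elim)
open import Data.Product using (_×_; _,_; proj₁; proj₂; ∃-syntax)
import Data.Product as Product
open import Data.Sum using (_⊎_; inj₁; inj₂)
open import Function using (_∘_)
open import Function.Definitions using (Injective)
open import Relation.Nullary using (¬_; yes; no)
open import Relation.Nullary.Reflects using (ofʸ; ofⁿ; fromEquivalence)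
open import Relation.Binary using (tri<; tri≈; tri>)
open import Relation.Binary.PropositionalEquality
  using (_≡_; _≢_; refl; sym; trans; cong; subst; subst₂; setoid; module ≡-Reasoning)

shift-< : ∀ {s ℓ} → ℓ < s → shift s ℓ ≡ ℓ
shift-< {s} {ℓ} ℓ<s with ℓ <ᵇ s | <ᵇ-reflects-< ℓ s
... | true  | _        = refl
... | false | ofⁿ ℓ≮s = ⊥-elim (ℓ≮s ℓ<s)

shift-≥ : ∀ {s ℓ} → s ≤ ℓ → shift s ℓ ≡ suc ℓ
shift-≥ {s} {ℓ} s≤ℓ with ℓ <ᵇ s | <ᵇ-reflects-< ℓ s
... | true  | ofʸ ℓ<s = ⊥-elim (<⇒≱ ℓ<s s≤ℓ)
... | false | _       = refl

red-< : ∀ {s j} → j < s → red s j ≡ j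
red-< {s} {j} j<s with j <ᵇ s | <ᵇ-reflects-< j s
... | true  | _        = refl
... | false | ofⁿ j≮s = ⊥-elim (j≮s j<s)

red-≥ : ∀ {s j} → s ≤ j → red s j ≡ j ∸ 1
red-≥ {s} {j} s≤j with j <ᵇ s | <ᵇ-reflects-< j s
... | true  | ofʸ j<s = ⊥-elim (<⇒≱ j<s s≤j)
... | false | _       = refl

minusLab-suc : ∀ s → minusLab s (suc s) ≡ s
minusLab-suc s with suc s ≡ᵇ suc s | fromEquivalence (≡ᵇ⇒≡ (suc s) (suc s)) (≡⇒≡ᵇ (suc s) (suc s))
... | true  | _      = refl
... | false | ofⁿ ≢ = ⊥-elim (≢ refl)

minusLab-other : ∀ {s x} → x ≢ suc s → minusLab s x ≡ x
minusLab-other {s} {x} x≢ with x ≡ᵇ suc s | fromEquivalence (≡ᵇ⇒≡ x (suc s)) (≡⇒≡ᵇ x (suc s))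
... | true  | ofʸ x≡ = ⊥-elim (x≢ x≡)
... | false | _      = refl

red-shift : ∀ s ℓ → red s (shift s ℓ) ≡ ℓ
red-shift s ℓ with ℓ <? s
... | yes ℓ<s = trans (cong (red s) (shift-< ℓ<s)) (red-< ℓ<s)
... | no  ℓ≮s = trans (cong (red s) (shift-≥ (≮⇒≥ ℓ≮s))) (red-≥ (m≤n⇒m≤1+n (≮⇒≥ ℓ≮s)))

shift-red : ∀ {s j} → s ≢ j → shift s (red s j) ≡ j
shift-red {s} {j} s≢j with <-cmp j s
... | tri< j<s _ _ = trans (cong (shift s) (red-< j<s)) (shift-< j<s)
... | tri≈ _ j≡s _ = ⊥-elim (s≢j (sym j≡s))
... | tri> _ _ (s≤s s≤k) = trans (cong (shift s) (red-≥ (m≤n⇒m≤1+n s≤k))) (shift-≥ s≤k)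

shift-injective : ∀ s {a b} → shift s a ≡ shift s b → a ≡ b
shift-injective s {a} {b} e = begin
  a                 ≡⟨ sym (red-shift s a) ⟩
  red s (shift s a) ≡⟨ cong (red s) e ⟩
  red s (shift s b) ≡⟨ red-shift s b ⟩
  b                 ∎
  where open ≡-Reasoning

red-injective-off : ∀ {s j k} → s ≢ j → s ≢ k → red s j ≡ red s k → j ≡ k
red-injective-off {s} {j} {k} s≢j s≢k e = begin
  j                 ≡⟨ sym (shift-red s≢j) ⟩
  shift s (red s j) ≡⟨ cong (shift s) e ⟩
  shift s (red s k) ≡⟨ shift-red s≢k ⟩
  k                 ∎
  where open ≡-Reasoning

-- s is the one value missed by shift s: no vertex of G⁺ is labelled s.
shift≢ : ∀ s ℓ → shift s ℓ ≢ s
shift≢ s ℓ with ℓ <? s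
... | yes ℓ<s = λ e → <-irrefl (trans (sym (shift-< ℓ<s)) e) ℓ<s
... | no  ℓ≮s = λ e → 1+n≰n (subst (_≤ ℓ) (trans (sym e) (shift-≥ s≤ℓ)) s≤ℓ)
  where
  s≤ℓ : s ≤ ℓ
  s≤ℓ = ≮⇒≥ ℓ≮s

-- s+1 is never a label of G⁻.
minusLab≢ : ∀ s x → minusLab s x ≢ suc s
minusLab≢ s x with x ≟ suc s
... | yes refl = λ e → 1+n≢n (sym (trans (sym (minusLab-suc s)) e))
... | no  x≢   = λ e → x≢ (trans (sym (minusLab-other x≢)) e)

-- minusLab s only merges s+1 with s, so it is injective away from s.
minusLab-injective-off : ∀ {s x y} → s ≢ x → s ≢ y → minusLab s x ≡ minusLab s y → x ≡ y
minusLab-injective-off {s} {x} {y} s≢x s≢y e with x ≟ suc s | y ≟ suc s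
... | yes x≡ | yes y≡ = trans x≡ (sym y≡)
... | yes refl | no y≢ = ⊥-elim (s≢y (trans (sym (minusLab-suc s)) (trans e (minusLab-other y≢))))
... | no x≢ | yes refl = ⊥-elim (s≢x (sym (trans (sym (minusLab-other x≢)) (trans e (minusLab-suc s)))))
... | no x≢ | no y≢ = trans (sym (minusLab-other x≢)) (trans e (minusLab-other y≢))

minus-shift-injective : ∀ s {a b} → minusLab s (shift s a) ≡ minusLab s (shift s b) → a ≡ b
minus-shift-injective s {a} {b} e =
  shift-injective s (minusLab-injective-off (shift≢ s a ∘ sym) (shift≢ s b ∘ sym) e)

-- `Below ds i j`: in the list ds the symbol i occurs strictly after j.  When ds lists
-- the symbols in decreasing order this says c_i < c_j.
Below : List ℕ → ℕ → ℕ → Set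
Below ds i j = ∃[ xs ] ∃[ ys ] ∃[ zs ] (ds ≡ xs ++ j ∷ ys ++ i ∷ zs)

reverse-split : ∀ (xs : List ℕ) x ys → reverse (xs ++ x ∷ ys) ≡ reverse ys ++ x ∷ reverse xs
reverse-split xs x ys = begin
  reverse (xs ++ x ∷ ys)              ≡⟨ reverse-++ xs (x ∷ ys) ⟩
  reverse (x ∷ ys) ++ reverse xs      ≡⟨ cong (_++ reverse xs) (unfold-reverse x ys) ⟩
  (reverse ys ++ x ∷ []) ++ reverse xs ≡⟨ ++-assoc (reverse ys) (x ∷ []) (reverse xs) ⟩
  reverse ys ++ x ∷ reverse xs        ∎
  where open ≡-Reasoning

<[]⇒Below : ∀ {cs i j} → i <[ cs ] j → Below (reverse cs) i j
<[]⇒Below {cs} {i} {j} (xs , ys , zs , cs≡) = reverse zs , reverse ys , reverse xs , (begin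
  reverse cs                                       ≡⟨ cong reverse cs≡ ⟩
  reverse (xs ++ i ∷ ys ++ j ∷ zs)                 ≡⟨ reverse-split xs i (ys ++ j ∷ zs) ⟩
  reverse (ys ++ j ∷ zs) ++ i ∷ reverse xs         ≡⟨ cong (_++ i ∷ reverse xs) (reverse-split ys j zs) ⟩
  (reverse zs ++ j ∷ reverse ys) ++ i ∷ reverse xs ≡⟨ ++-assoc (reverse zs) (j ∷ reverse ys) (i ∷ reverse xs) ⟩
  reverse zs ++ j ∷ reverse ys ++ i ∷ reverse xs   ∎)
  where open ≡-Reasoning

Below-tail : ∀ {x ds i j} → Below (x ∷ ds) i j → j ≢ x → Below ds i j
Below-tail ([] , _ , _ , e) j≢x = ⊥-elim (j≢x (sym (∷-injectiveˡ e)))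
Below-tail (_ ∷ xs , ys , zs , e) _ = xs , ys , zs , ∷-injectiveʳ e

Below-map : ∀ f {ds i j} → Below ds i j → Below (map f ds) (f i) (f j)
Below-map f {i = i} {j} (xs , ys , zs , e) = map f xs , map f ys , map f zs , (begin
  map f _                           ≡⟨ cong (map f) e ⟩
  map f (xs ++ j ∷ ys ++ i ∷ zs)     ≡⟨ map-++ f xs (j ∷ ys ++ i ∷ zs) ⟩
  map f xs ++ f j ∷ map f (ys ++ i ∷ zs) ≡⟨ cong (λ l → map f xs ++ f j ∷ l) (map-++ f ys (i ∷ zs)) ⟩
  map f xs ++ f j ∷ map f ys ++ f i ∷ map f zs ∎)
  where open ≡-Reasoning

head-not-below : ∀ {s ds j} → Unique (s ∷ ds) → ¬ Below (s ∷ ds) s j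
head-not-below {s} (s∉ds ∷ _) (xs , ys , zs , e) = All.lookup s∉ds (s∈ds xs e) refl
  where
  s∈ds : ∀ {ds j} xs → s ∷ ds ≡ xs ++ j ∷ ys ++ s ∷ zs → s ∈ ds
  s∈ds []        e = subst (s ∈_) (sym (∷-injectiveʳ e)) (∈-++⁺ʳ ys (here refl))
  s∈ds (_ ∷ xs′) e = subst (s ∈_) (sym (∷-injectiveʳ e)) (∈-++⁺ʳ xs′ (there (∈-++⁺ʳ ys (here refl))))

Below-irrefl : ∀ {ds i} → Unique ds → ¬ Below ds i i
Below-irrefl u ([] , ys , zs , refl) = head-not-below u ([] , ys , zs , refl)
Below-irrefl (_ ∷ u) (_ ∷ xs , ys , zs , e) = Below-irrefl u (xs , ys , zs , ∷-injectiveʳ e)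

map-unique : ∀ {P : ℕ → Set} {xs} (f : ℕ → ℕ) → (∀ {x y} → P x → P y → f x ≡ f y → x ≡ y) →
             All P xs → Unique xs → Unique (map f xs)
map-unique f inj [] [] = []
map-unique {P} f inj (px ∷ pxs) (x∉xs ∷ u) = fresh px pxs x∉xs ∷ map-unique f inj pxs u
  where
  fresh : ∀ {x ys} → P x → All P ys → All (x ≢_) ys → All (f x ≢_) (map f ys)
  fresh px []         []           = []
  fresh px (py ∷ pys) (x≢y ∷ x∉ys) = (x≢y ∘ inj px py) ∷ fresh px pys x∉ys

injective-on-Fin1 : ∀ {A : Set} {f : Fin 1 → A} → Injective _≡_ _≡_ f
injective-on-Fin1 {x = fzero} {fzero} _ = refl

injective-snoc : ∀ {A : Set} {k} {f : Fin (suc k) → A} → Injective _≡_ _≡_ (f ∘ inject₁) →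
                 (∀ p → f (inject₁ p) ≢ f (fromℕ k)) → Injective _≡_ _≡_ f
injective-snoc inj new {x} {y} e with view x | view y
... | ‵fromℕ     | ‵fromℕ     = refl
... | ‵inject₁ p | ‵inject₁ q = cong inject₁ (inj e)
... | ‵inject₁ p | ‵fromℕ     = ⊥-elim (new p e)
... | ‵fromℕ     | ‵inject₁ q = ⊥-elim (new q (sym e))

constant-along : ∀ {A : Set} k (f : Fin (suc k) → A) →
                 (∀ p → f (inject₁ p) ≡ f (fsuc p)) → ∀ p → f p ≡ f fzero
constant-along zero    f step fzero    = refl
constant-along (suc k) f step fzero    = refl
constant-along (suc k) f step (fsuc p) =
  trans (sym (step p)) (constant-along k (f ∘ inject₁) (step ∘ inject₁) p)

Edge : (n : ℕ) → List ℕ → Vtx n → Vtx n → ℕ → Set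
Edge n ds v w i = Adj n ds v w i ⊎ Adj n ds w v i

adj-base : ∀ {ds x y i} → Adj zero ds x y i → i ≡ 1 × x ≢ y
adj-base base = refl , λ ()

edge-base : ∀ {ds x y i} → Edge zero ds x y i → i ≡ 1 × x ≢ y
edge-base (inj₁ a) = adj-base a
edge-base (inj₂ a) = Product.map₂ (_∘ sym) (adj-base a)

vlab-base-injective : ∀ {ds} → Injective _≡_ _≡_ (vlab zero ds)
vlab-base-injective {x = false} {false} _ = refl
vlab-base-injective {x = true}  {true}  _ = refl

adj-project : ∀ {m s ds x y i} → Adj (suc m) (s ∷ ds) x y i → i ≢ s →
              proj₁ x ≡ proj₁ y × Adj m (map (red s) ds) (proj₂ x) (proj₂ y) (red s i)
adj-project {s = s} (plus  {ℓ = ℓ} a) _ = refl , subst (Adj _ _ _ _) (sym (red-shift s ℓ)) a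
adj-project {s = s} (minus {ℓ = ℓ} a) _ = refl , subst (Adj _ _ _ _) (sym (red-shift s ℓ)) a
adj-project (cross _) s≢s = ⊥-elim (s≢s refl)

edge-project : ∀ {m s ds x y i} → Edge (suc m) (s ∷ ds) x y i → i ≢ s →
               proj₁ x ≡ proj₁ y × Edge m (map (red s) ds) (proj₂ x) (proj₂ y) (red s i)
edge-project (inj₁ a) i≢s = Product.map₂ inj₁ (adj-project a i≢s)
edge-project (inj₂ a) i≢s = Product.map sym inj₂ (adj-project a i≢s)

copy-label-injective : ∀ {m s ds} (x y : Vtx (suc m)) → proj₁ x ≡ proj₁ y →
  vlab (suc m) (s ∷ ds) x ≡ vlab (suc m) (s ∷ ds) y →
  vlab m (map (red s) ds) (proj₂ x) ≡ vlab m (map (red s) ds) (proj₂ y)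
copy-label-injective {s = s} (true  , _) (true  , _) refl e = shift-injective s e
copy-label-injective {s = s} (false , _) (false , _) refl e = minus-shift-injective s e

-- An edge labelled s is a cross edge; its end y has label s (in G⁻) or s+1 (in G⁺),
-- which no vertex z in the copy of its other end x carries.
cross-fresh : ∀ {m s ds x y z i} → Edge (suc m) (s ∷ ds) x y i → i ≡ s → proj₁ z ≡ proj₁ x →
              vlab (suc m) (s ∷ ds) z ≢ vlab (suc m) (s ∷ ds) y
cross-fresh {s = s} (inj₁ (plus  {ℓ = ℓ} _)) i≡s _ = ⊥-elim (shift≢ s ℓ i≡s)
cross-fresh {s = s} (inj₁ (minus {ℓ = ℓ} _)) i≡s _ = ⊥-elim (shift≢ s ℓ i≡s)
cross-fresh {s = s} (inj₂ (plus  {ℓ = ℓ} _)) i≡s _ = ⊥-elim (shift≢ s ℓ i≡s)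
cross-fresh {s = s} (inj₂ (minus {ℓ = ℓ} _)) i≡s _ = ⊥-elim (shift≢ s ℓ i≡s)
cross-fresh {s = s} {z = true , _} (inj₁ (cross x+)) _ refl e =
  shift≢ s _ (trans e (trans (cong (minusLab s) x+) (minusLab-suc s)))
cross-fresh {m} {s} {ds} {z = false , u} (inj₂ (cross y+)) _ refl e =
  minusLab≢ s (shift s (vlab m (map (red s) ds) u)) (trans e y+)

-- A path v₀ … v_len with edge labels is; consecutive labels increase in the order,
-- i.e. each label is below the next one in the decreasing list ds.
record OrderedPath (n : ℕ) (ds : List ℕ) {len : ℕ}
                   (vs : Fin (suc len) → Vtx n) (is : Fin len → ℕ) : Set where
  field
    edge    : ∀ p → Edge n ds (vs (inject₁ p)) (vs (fsuc p)) (is p)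
    ordered : ∀ p q → toℕ q ≡ suc (toℕ p) → Below ds (is p) (is q)

open OrderedPath

consecutive : ∀ {n ds k vs is} → OrderedPath n ds {suc k} vs is →
              ∀ (p : Fin k) → Below ds (is (inject₁ p)) (is (fsuc p))
consecutive path p = ordered path (inject₁ p) (fsuc p) (cong suc (sym (toℕ-inject₁ p)))

init-path : ∀ {n ds k vs is} → OrderedPath n ds {suc k} vs is →
            OrderedPath n ds (vs ∘ inject₁) (is ∘ inject₁)
init-path path = record
  { edge    = edge path ∘ inject₁
  ; ordered = λ p q q=p+1 → ordered path (inject₁ p) (inject₁ q)
      (trans (toℕ-inject₁ q) (trans q=p+1 (cong suc (sym (toℕ-inject₁ p)))))
  }

-- Since c_s is maximal, only the last edge of an ordered path can carry the label s.
top-only-last : ∀ {n s ds k vs is} → Unique (s ∷ ds) → OrderedPath n (s ∷ ds) {suc k} vs is →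
                ∀ p → is (inject₁ p) ≢ s
top-only-last {s = s} {ds} {is = is} u path p is≡s =
  head-not-below u (subst (λ i → Below (s ∷ ds) i (is (fsuc p))) is≡s (consecutive path p))

one-copy : ∀ {m s ds k vs is} → OrderedPath (suc m) (s ∷ ds) {k} vs is → (∀ p → is p ≢ s) →
           ∀ p → proj₁ (vs p) ≡ proj₁ (vs fzero)
one-copy {k = k} {vs} path avoid =
  constant-along k (proj₁ ∘ vs) (λ p → proj₁ (edge-project (edge path p) (avoid p)))

project-path : ∀ {m s ds k vs is} → OrderedPath (suc m) (s ∷ ds) {k} vs is → (∀ p → is p ≢ s) →
               OrderedPath m (map (red s) ds) (proj₂ ∘ vs) (red s ∘ is)
project-path {s = s} path avoid = record
  { edge    = λ p → proj₂ (edge-project (edge path p) (avoid p))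
  ; ordered = λ p q q=p+1 → Below-map (red s) (Below-tail (ordered path p q q=p+1) (avoid q))
  }

Distinct : ℕ → List ℕ → Set
Distinct n ds = ∀ {len} {vs : Fin (suc len) → Vtx n} {is : Fin len → ℕ} → OrderedPath n ds vs is →
                Injective _≡_ _≡_ is × Injective _≡_ _≡_ (vlab n ds ∘ vs)

-- t = 1: a path has at most one edge, since two edges would both be labelled 1.
distinct-base : ∀ {ds} → Unique ds → Distinct zero ds
distinct-base u {zero} path = (λ { {()} }) , injective-on-Fin1
distinct-base {ds} u {suc zero} {vs} path = injective-on-Fin1 , injective-snoc injective-on-Fin1 ends-differ
  where
  ends-differ : ∀ p → vlab zero ds (vs (inject₁ p)) ≢ vlab zero ds (vs (fromℕ 1))
  ends-differ fzero e = proj₂ (edge-base (edge path fzero)) (vlab-base-injective e)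
distinct-base u {suc (suc k)} path = ⊥-elim (Below-irrefl u
  (subst₂ (Below _) (proj₁ (edge-base (edge path fzero))) (proj₁ (edge-base (edge path (fsuc fzero))))
          (consecutive path fzero)))

distinct-empty : ∀ {m} → Distinct (suc m) []
distinct-empty {len = zero} path = (λ { {()} }) , injective-on-Fin1
distinct-empty {len = suc _} path with edge path fzero
... | inj₁ ()
... | inj₂ ()

distinct-in-copy : ∀ {m s ds k vs is} → Distinct m (map (red s) ds) →
                   OrderedPath (suc m) (s ∷ ds) {k} vs is → (∀ p → is p ≢ s) →
                   Injective _≡_ _≡_ is × Injective _≡_ _≡_ (vlab (suc m) (s ∷ ds) ∘ vs)
distinct-in-copy {m} {s} {ds} {vs = vs} {is} IH path avoid =
    (λ e → labels-inj (cong (red s) e))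
  , (λ {p} {q} e → vertices-inj (copy-label-injective (vs p) (vs q) (trans (same p) (sym (same q))) e))
  where
  labels-inj : Injective _≡_ _≡_ (red s ∘ is)
  labels-inj = proj₁ (IH (project-path path avoid))

  vertices-inj : Injective _≡_ _≡_ (vlab m (map (red s) ds) ∘ proj₂ ∘ vs)
  vertices-inj = proj₂ (IH (project-path path avoid))

  same : ∀ p → proj₁ (vs p) ≡ proj₁ (vs fzero)
  same = one-copy path avoid

-- Inductive step: either no edge is labelled s, or only the last one is, and then it
-- is a cross edge leading to a fresh label.
distinct-step : ∀ {m s ds} → Unique (s ∷ ds) → Distinct m (map (red s) ds) → Distinct (suc m) (s ∷ ds)
distinct-step u IH {zero} path = distinct-in-copy IH path (λ ())
distinct-step {m} {s} {ds} u IH {suc len} {vs} {is} path with is (fromℕ len) ≟ s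
... | no last≢s = distinct-in-copy IH path avoid
  where
  avoid : ∀ p → is p ≢ s
  avoid p with view p
  ... | ‵fromℕ     = last≢s
  ... | ‵inject₁ q = top-only-last u path q
... | yes last≡s =
    injective-snoc (proj₁ prefix) (λ p e → before p (trans e last≡s))
  , injective-snoc (proj₂ prefix) fresh
  where
  lab : Vtx (suc m) → ℕ
  lab = vlab (suc m) (s ∷ ds)

  before : ∀ p → is (inject₁ p) ≢ s
  before = top-only-last u path

  prefix : Injective _≡_ _≡_ (is ∘ inject₁) × Injective _≡_ _≡_ (lab ∘ vs ∘ inject₁)
  prefix = distinct-in-copy IH (init-path path) before

  same : ∀ p → proj₁ (vs (inject₁ p)) ≡ proj₁ (vs fzero)
  same = one-copy (init-path path) before

  fresh : ∀ p → lab (vs (inject₁ p)) ≢ lab (vs (fromℕ (suc len)))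
  fresh p = cross-fresh (edge path (fromℕ len)) last≡s (trans (same p) (sym (same (fromℕ len))))

distinct : ∀ n ds → Unique ds → Distinct n ds
distinct zero    ds       u = distinct-base u
distinct (suc m) []       _ = distinct-empty
distinct (suc m) (s ∷ ds) u@(s∉ds ∷ u′) =
  distinct-step u (distinct m (map (red s) ds) (map-unique (red s) red-injective-off s∉ds u′))

-- A linear order lists each symbol exactly once, so its reversal is duplicate-free.
reverse-unique : ∀ {t cs} → IsLinearOrder t cs → Unique (reverse cs)
reverse-unique {t} {cs} order =
  Unique-resp-↭ (setoid ℕ) (↭⇒↭ₛ (↭-sym (↭-trans (↭-reverse cs) order)))
    (UniqueProps.map⁺ suc-injective (UniqueProps.upTo⁺ t))

lemma5p6p7 : (n : ℕ) (cs : List ℕ) → IsLinearOrder (suc n) cs →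
    (len : ℕ) (vs : Fin (suc len) → Vtx n) (is : Fin len → ℕ) →
    ((p : Fin len) → Joined n cs (vs (inject₁ p)) (vs (fsuc p)) (is p)) →
    ((p q : Fin len) → toℕ q ≡ suc (toℕ p) → is p <[ cs ] is q) →
    ((p q : Fin len) → is p ≡ is q → p ≡ q)
    × ((p q : Fin (suc len)) → label n cs (vs p) ≡ label n cs (vs q) → p ≡ q)
lemma5p6p7 n cs order len vs is edges increasing =
  (λ _ _ → proj₁ distinct-path) , (λ _ _ → proj₂ distinct-path)
  where
  path : OrderedPath n (reverse cs) vs is
  path = record { edge = edges ; ordered = λ p q q=p+1 → <[]⇒Below (increasing p q q=p+1) }

  distinct-path : Injective _≡_ _≡_ is × Injective _≡_ _≡_ (label n cs ∘ vs)
  distinct-path = distinct n (reverse cs) (reverse-unique order) path
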